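{- There are infinitely many positive integers $n$ such that $n \mid \sum_{i=1}^{n} L_i$, where $(L_n)_{n\ge 0}$ is the Lucas sequence.
   Context: The Lucas numbers are defined by $L_0=2$, $L_1=1$, and $L_{n+1}=L_n+L_{n-1}$ for $n\ge 1$. -}

module Defs where

open import Data.Nat using (ℕ; zero; suc; _+_)

L : ℕ → ℕ
L zero = 2
L (suc zero) = 1
L (suc (suc n)) = L (suc n) + L n

lucasSum : ℕ → ℕ
lucasSum zero = 0
lucasSum (suc n) = lucasSum n + L (suc n)

module Submission where

-- Write F for the Fibonacci numbers.  Two classical identities turn the
-- Lucas sum into Fibonacci numbers:
--     L₁ + ⋯ + Lₙ + 3 = Lₙ₊₂ = Fₙ₊₁ + Fₙ₊₃ .
-- Say that the Fibonacci sequence *restarts modulo m after n = p+1 steps* when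
-- (Fₚ, Fₚ₊₁) ≡ (1, 0) = (F₋₁, F₀) (mod m).  Then Fₙ₊₁ ≡ 1 and Fₙ₊₃ ≡ 2, so
-- m divides L₁ + ⋯ + Lₙ.  Hence it suffices to find infinitely many n for which
-- F restarts modulo 2n after n steps.  This holds for n = 24 by computation, and
-- the doubling formulas F₂ₙ = Fₙ (Fₙ₊₁ + Fₙ₋₁), F₂ₙ₋₁ = Fₙ² + Fₙ₋₁² (special cases
-- of the addition formula) show that a restart modulo 2k after n steps yields a
-- restart modulo 4k after 2n steps.  So every n = 24·2ʲ works.

open import Defs
open import Data.Nat using (ℕ; _<_)
open import Data.Nat.Divisibility using (_∣_)
open import Data.Product using (∃-syntax; _×_)

open import Data.Nat using (zero; suc; _+_; _*_; _≤_; s≤s; z≤n)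
open import Data.Nat.Properties using (+-suc; +-cancelʳ-≡; ≤-trans; m≤m+n)
open import Data.Nat.Divisibility using (divides; ∣-trans; n∣m*n)
open import Data.Product using (_,_)
open import Relation.Binary.PropositionalEquality using (_≡_; refl; cong; cong₂; trans; subst; module ≡-Reasoning)
open import Data.Nat.Tactic.RingSolver using (solve-∀)

open ≡-Reasoning

fib : ℕ → ℕ
fib zero = 0
fib (suc zero) = 1
fib (suc (suc n)) = fib (suc n) + fib n

fib-+ : ∀ a b → fib (suc (a + b)) ≡ fib (suc a) * fib (suc b) + fib a * fib b
fib-+ zero b = shape (fib (suc b)) (fib b)
  where
  shape : ∀ x y → x ≡ 1 * x + 0 * y
  shape = solve-∀
fib-+ (suc a) b = begin
    fib (suc (suc a + b))
  ≡⟨ cong (λ k → fib (suc k)) (+-suc a b) ⟨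
    fib (suc (a + suc b))
  ≡⟨ fib-+ a (suc b) ⟩
    fib (suc a) * (fib (suc b) + fib b) + fib a * fib (suc b)
  ≡⟨ regroup (fib (suc a)) (fib a) (fib (suc b)) (fib b) ⟩
    fib (suc (suc a)) * fib (suc b) + fib (suc a) * fib b
  ∎
  where
  regroup : ∀ x y u v → x * (u + v) + y * u ≡ (x + y) * u + x * v
  regroup = solve-∀

lucas-fib : ∀ n → L (suc n) ≡ fib n + fib (suc (suc n))
lucas-fib zero = refl
lucas-fib (suc zero) = refl
lucas-fib (suc (suc n)) =
  trans (cong₂ _+_ (lucas-fib (suc n)) (lucas-fib n)) (regroup (fib n) (fib (suc n)))
  where
  regroup : ∀ x y → (y + (y + x + y)) + (x + (y + x)) ≡ (y + x) + ((y + x + y) + (y + x))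
  regroup = solve-∀

lucasSum-closed : ∀ n → lucasSum n + 3 ≡ L (suc (suc n))
lucasSum-closed zero = refl
lucasSum-closed (suc n) = begin
    lucasSum n + L (suc n) + 3
  ≡⟨ swap (lucasSum n) (L (suc n)) ⟩
    lucasSum n + 3 + L (suc n)
  ≡⟨ cong (_+ L (suc n)) (lucasSum-closed n) ⟩
    L (suc (suc (suc n)))
  ∎
  where
  swap : ∀ x y → x + y + 3 ≡ x + 3 + y
  swap = solve-∀

-- The Fibonacci sequence restarts modulo m after p+1 steps:
-- F(p) ≡ 1 and F(p+1) ≡ 0 (mod m), with explicit quotients.
Restarts : ℕ → ℕ → Set
Restarts m p = ∃[ a ] ∃[ b ] (fib (suc p) ≡ m * a × fib p ≡ 1 + m * b)

-- Divisibility criterion: a restart modulo m after n steps forces m ∣ L₁ + ⋯ + Lₙ,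
-- because L₁ + ⋯ + Lₙ + 3 = Fₙ₊₁ + Fₙ₊₃ ≡ 1 + 2 (mod m).
restart⇒∣lucasSum : ∀ m p → Restarts m p → m ∣ lucasSum (suc p)
restart⇒∣lucasSum m p (a , b , fₙ≡ , fₙ₋₁≡) =
  divides (4 * a + 3 * b) (+-cancelʳ-≡ 3 _ _ sum+3)
  where
  x y : ℕ
  x = fib (suc p)
  y = fib p
  sum+3 : lucasSum (suc p) + 3 ≡ (4 * a + 3 * b) * m + 3
  sum+3 = begin
      lucasSum (suc p) + 3
    ≡⟨ lucasSum-closed (suc p) ⟩
      L (suc (suc (suc p)))
    ≡⟨ lucas-fib (suc (suc p)) ⟩
      (x + y) + ((x + y + x) + (x + y))
    ≡⟨ cong₂ (λ u v → (u + v) + ((u + v + u) + (u + v))) fₙ≡ fₙ₋₁≡ ⟩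
      (m * a + (1 + m * b)) + ((m * a + (1 + m * b) + m * a) + (m * a + (1 + m * b)))
    ≡⟨ reduce m a b ⟩
      (4 * a + 3 * b) * m + 3
    ∎
    where
    reduce : ∀ m a b →
      (m * a + (1 + m * b)) + ((m * a + (1 + m * b) + m * a) + (m * a + (1 + m * b)))
        ≡ (4 * a + 3 * b) * m + 3
    reduce = solve-∀

-- Doubling step: a restart modulo 2k after n = p+1 steps gives a restart modulo 4k
-- after 2n steps, by F₂ₙ = Fₙ(Fₙ + 2Fₙ₋₁) and F₂ₙ₋₁ = Fₙ² + Fₙ₋₁².
restart-double : ∀ k p → Restarts (2 * k) p → Restarts (4 * k) (suc (p + p))
restart-double k p (a , b , fₙ≡ , fₙ₋₁≡) =
  a * (1 + k * (a + 2 * b)) , k * a * a + b + k * b * b , f₂ₙ≡ , f₂ₙ₋₁≡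
  where
  x y : ℕ
  x = fib (suc p)
  y = fib p
  f₂ₙ≡ : fib (suc (suc p + p)) ≡ 4 * k * (a * (1 + k * (a + 2 * b)))
  f₂ₙ≡ = begin
      fib (suc (suc p + p))
    ≡⟨ fib-+ (suc p) p ⟩
      (x + y) * x + x * y
    ≡⟨ cong₂ (λ u v → (u + v) * u + u * v) fₙ≡ fₙ₋₁≡ ⟩
      (2 * k * a + (1 + 2 * k * b)) * (2 * k * a) + 2 * k * a * (1 + 2 * k * b)
    ≡⟨ reduce k a b ⟩
      4 * k * (a * (1 + k * (a + 2 * b)))
    ∎
    where
    reduce : ∀ k a b →
      (2 * k * a + (1 + 2 * k * b)) * (2 * k * a) + 2 * k * a * (1 + 2 * k * b)
        ≡ 4 * k * (a * (1 + k * (a + 2 * b)))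
    reduce = solve-∀
  f₂ₙ₋₁≡ : fib (suc (p + p)) ≡ 1 + 4 * k * (k * a * a + b + k * b * b)
  f₂ₙ₋₁≡ = begin
      fib (suc (p + p))
    ≡⟨ fib-+ p p ⟩
      x * x + y * y
    ≡⟨ cong₂ (λ u v → u * u + v * v) fₙ≡ fₙ₋₁≡ ⟩
      2 * k * a * (2 * k * a) + (1 + 2 * k * b) * (1 + 2 * k * b)
    ≡⟨ reduce k a b ⟩
      1 + 4 * k * (k * a * a + b + k * b * b)
    ∎
    where
    reduce : ∀ k a b →
      2 * k * a * (2 * k * a) + (1 + 2 * k * b) * (1 + 2 * k * b)
        ≡ 1 + 4 * k * (k * a * a + b + k * b * b)
    reduce = solve-∀

-- The indices n = 24·2ʲ, stored as their predecessors 23, 47, 95, …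
goodIndex : ℕ → ℕ
goodIndex zero = 23
goodIndex (suc j) = suc (goodIndex j + goodIndex j)

goodIndex-≥ : ∀ j → j ≤ goodIndex j
goodIndex-≥ zero = z≤n
goodIndex-≥ (suc j) = s≤s (≤-trans (goodIndex-≥ j) (m≤m+n (goodIndex j) (goodIndex j)))

-- Every good index n restarts F modulo 2n: base case F₂₄ = 48·966, F₂₃ = 1 + 48·597,
-- then the doubling step, noting 4·n = 2·(2n).
goodIndex-restarts : ∀ j → Restarts (2 * suc (goodIndex j)) (goodIndex j)
goodIndex-restarts zero = 966 , 597 , refl , refl
goodIndex-restarts (suc j) =
  subst (λ m → Restarts m (suc (p + p))) (four-n p) (restart-double (suc p) p (goodIndex-restarts j))
  where
  p : ℕ
  p = goodIndex j
  four-n : ∀ p → 4 * suc p ≡ 2 * suc (suc (p + p))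
  four-n = solve-∀

mainTheorem5 : ∀ (m : ℕ) → ∃[ n ] (m < n × n ∣ lucasSum n)
mainTheorem5 m = suc p , s≤s (goodIndex-≥ m) ,
  ∣-trans (n∣m*n 2) (restart⇒∣lucasSum (2 * suc p) p (goodIndex-restarts m))
  where
  p : ℕ
  p = goodIndex m
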